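{- (Subject reduction.) For every typed term $M$ and type $\sigma$: if $M:\sigma$ and $M\to^* N$, then $N:\sigma$.
   Context: Types: type expressions are generated by $\sigma ::= t \mid \sigma+\sigma \mid \sigma\times\sigma\mid \sigma\to\sigma\mid \mu t.\sigma\mid \mathrm{void}$ ($t$ type variables); types are closed type expressions. Simple types: $\tau::=\mathrm{void}\mid\tau+\tau\mid\tau\times\tau\mid\tau\to\tau$. The prefix relation $\preceq$ is the least relation with $\mathrm{void}\preceq\tau$ for all types $\tau$ and $\sigma\preceq\sigma',\tau\preceq\tau'\Rightarrow\sigma\star\tau\preceq\sigma'\star\tau'$ ($\star\in\{+,\times,\to\}$, $\sigma,\tau$ simple). Unfolding $\rhd$: least relation with $\mu t.\tau\rhd\tau[\mu t.\tau/t]$, closed under $\star$ in either argument; $\rhd^*$ its reflexive transitive closure; $\tau\!\uparrow=\{\sigma\text{ simple}\mid\exists\tau'(\tau\rhd^*\tau',\sigma\preceq\tau')\}$; $\sigma\approx\tau$ iff $\sigma\!\uparrow=\tau\!\uparrow$. Terms: for each type $\sigma$ there is a countable set of variables $x^\sigma$. Constants, for all types $\sigma,\tau,\rho$ ($\to$ associates to the right): $0_{\sigma,\tau}:\sigma\to(\sigma+\tau)$, $1_{\sigma,\tau}:\tau\to(\sigma+\tau)$, $\mathrm{case}_{\sigma,\tau,\rho}:(\sigma+\tau)\to(\sigma\to\rho)\to(\tau\to\rho)\to\rho$, $\mathrm{pcase}_{\sigma,\tau,\rho}:(\sigma+\tau)\to\rho\to\rho\to\rho$, $\mathrm{pair}_{\sigma,\tau}:\sigma\to\tau\to(\sigma\times\tau)$,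 $\mathrm{fst}_{\sigma,\tau}:(\sigma\times\tau)\to\sigma$, $\mathrm{snd}_{\sigma,\tau}:(\sigma\times\tau)\to\tau$, $\Omega_\sigma:\sigma$. Typing rules: each constant has its given type; $x^\sigma:\sigma$; if $M:\tau$ then $\lambda x^\sigma.M:\sigma\to\tau$; if $M:\sigma\to\tau$ and $N:\sigma$ then $MN:\tau$; if $M:\sigma$ and $\sigma\approx\tau$ then $M:\tau$. Terms are identified up to $\alpha$-conversion; $(M,N)$ abbreviates $\mathrm{pair}\,M\,N$. Reduction: $\to$ is the least relation on terms containing $(\lambda x.M)N\to M[x:=N]$ (capture-avoiding substitution), closed under contexts ($M\to M'$ implies $MN\to M'N$, $NM\to NM'$ and $\lambda x.M\to\lambda x.M'$), and containing the following rules, where $x,y,z,w,y_i,z_i$ stand for arbitrary terms: $\mathrm{case}\,(0x)\,y\,z\to y\,x$; $\mathrm{case}\,(1x)\,y\,z\to z\,x$; $\mathrm{fst}\,(x,y)\to x$; $\mathrm{snd}\,(x,y)\to y$; $\mathrm{pcase}\,(0x)\,y\,z\to y$; $\mathrm{pcase}\,(1x)\,y\,z\to z$; $\mathrm{pcase}_{\sigma,\tau,\rho_0+\rho_1}\,x\,(0y)\,(0z)\to 0\,(\mathrm{pcase}_{\sigma,\tau,\rho_0}\,x\,y\,z)$; $\mathrm{pcase}_{\sigma,\tau,\rho_0+\rho_1}\,x\,(1y)\,(1z)\to 1\,(\mathrm{pcase}_{\sigma,\tau,\rho_1}\,x\,y\,z)$; $\mathrm{pcase}_{\sigma,\tau,\rho_1\times\rho_2}\,x\,(y_1,y_2)\,(z_1,z_2)\to(\mathrm{pcase}_{\sigma,\tau,\rho_1}\,x\,y_1\,z_1,\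 \mathrm{pcase}_{\sigma,\tau,\rho_2}\,x\,y_2\,z_2)$; $(\mathrm{pcase}_{\sigma,\tau,\rho_1\to\rho_2}\,x\,y\,z)\,w\to\mathrm{pcase}_{\sigma,\tau,\rho_2}\,x\,(y\,w)\,(z\,w)$. $\to^*$ is the reflexive transitive closure of $\to$. -}

module Defs where

open import Data.Nat using (ℕ; zero; suc)
open import Data.Fin using (Fin; zero; suc)
open import Data.List using (List; []; _∷_)
open import Data.Product using (Σ; _×_; _,_; ∃)
open import Function.Bundles using (_⇔_)

-- Type expressions, scoped by the number of free type variables
-- (de Bruijn).  Types = closed type expressions = TyExp 0.

data TyExp (n : ℕ) : Set where
  tvar : Fin n → TyExp n
  _⊕_  : TyExp n → TyExp n → TyExp n
  _⊗_  : TyExp n → TyExp n → TyExp n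
  _⇒_  : TyExp n → TyExp n → TyExp n
  μ    : TyExp (suc n) → TyExp n               -- μ t. σ  (t bound = tvar zero)
  void : TyExp n

infixr 5 _⇒_
infixr 6 _⊕_
infixr 7 _⊗_

Ty : Set
Ty = TyExp 0

extR : ∀ {n m} → (Fin n → Fin m) → Fin (suc n) → Fin (suc m)
extR ρ zero    = zero
extR ρ (suc i) = suc (ρ i)

renTy : ∀ {n m} → (Fin n → Fin m) → TyExp n → TyExp m
renTy ρ (tvar i) = tvar (ρ i)
renTy ρ (a ⊕ b)  = renTy ρ a ⊕ renTy ρ b
renTy ρ (a ⊗ b)  = renTy ρ a ⊗ renTy ρ b
renTy ρ (a ⇒ b)  = renTy ρ a ⇒ renTy ρ b
renTy ρ (μ a)    = μ (renTy (extR ρ) a)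
renTy ρ void     = void

extS : ∀ {n m} → (Fin n → TyExp m) → Fin (suc n) → TyExp (suc m)
extS s zero    = tvar zero
extS s (suc i) = renTy suc (s i)

substTy : ∀ {n m} → (Fin n → TyExp m) → TyExp n → TyExp m
substTy s (tvar i) = s i
substTy s (a ⊕ b)  = substTy s a ⊕ substTy s b
substTy s (a ⊗ b)  = substTy s a ⊗ substTy s b
substTy s (a ⇒ b)  = substTy s a ⇒ substTy s b
substTy s (μ a)    = μ (substTy (extS s) a)
substTy s void     = void

_[_/t] : ∀ {n} → TyExp (suc n) → TyExp n → TyExp n
τ [ σ /t] = substTy s τ
  where
  s : Fin (suc _) → TyExp _
  s zero    = σ
  s (suc i) = tvar i

data STy : Set where
  void : STy
  _⊕_  : STy → STy → STy
  _⊗_  : STy → STy → STy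
  _⇒_  : STy → STy → STy

data _≼_ : STy → Ty → Set where
  void≼ : ∀ {τ} → void ≼ τ
  ⊕≼    : ∀ {σ τ σ' τ'} → σ ≼ σ' → τ ≼ τ' → (σ ⊕ τ) ≼ (σ' ⊕ τ')
  ⊗≼    : ∀ {σ τ σ' τ'} → σ ≼ σ' → τ ≼ τ' → (σ ⊗ τ) ≼ (σ' ⊗ τ')
  ⇒≼    : ∀ {σ τ σ' τ'} → σ ≼ σ' → τ ≼ τ' → (σ ⇒ τ) ≼ (σ' ⇒ τ')

data _▷_ : Ty → Ty → Set where
  unfold : ∀ {τ} → μ τ ▷ (τ [ μ τ /t])
  ⊕ˡ : ∀ {σ σ' τ} → σ ▷ σ' → (σ ⊕ τ) ▷ (σ' ⊕ τ)
  ⊕ʳ : ∀ {σ τ τ'} → τ ▷ τ' → (σ ⊕ τ) ▷ (σ ⊕ τ')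
  ⊗ˡ : ∀ {σ σ' τ} → σ ▷ σ' → (σ ⊗ τ) ▷ (σ' ⊗ τ)
  ⊗ʳ : ∀ {σ τ τ'} → τ ▷ τ' → (σ ⊗ τ) ▷ (σ ⊗ τ')
  ⇒ˡ : ∀ {σ σ' τ} → σ ▷ σ' → (σ ⇒ τ) ▷ (σ' ⇒ τ)
  ⇒ʳ : ∀ {σ τ τ'} → τ ▷ τ' → (σ ⇒ τ) ▷ (σ ⇒ τ')

data _▷*_ : Ty → Ty → Set where
  ▷refl : ∀ {τ} → τ ▷* τ
  ▷step : ∀ {τ τ' τ''} → τ ▷ τ' → τ' ▷* τ'' → τ ▷* τ''

_∈_↑ : STy → Ty → Set
σ ∈ τ ↑ = ∃ λ τ' → (τ ▷* τ') × (σ ≼ τ')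

_≈_ : Ty → Ty → Set
σ ≈ τ = ∀ (s : STy) → (s ∈ σ ↑) ⇔ (s ∈ τ ↑)

-- Terms (de Bruijn indices for term variables; a variable's type is
-- given by the typing context, which fixes the type σ of each x^σ).

data Const : Set where
  c0    : Ty → Ty → Const
  c1    : Ty → Ty → Const
  case  : Ty → Ty → Ty → Const
  pcase : Ty → Ty → Ty → Const
  pair  : Ty → Ty → Const
  fst   : Ty → Ty → Const
  snd   : Ty → Ty → Const
  Ω     : Ty → Const

constTy : Const → Ty
constTy (c0 σ τ)      = σ ⇒ (σ ⊕ τ)
constTy (c1 σ τ)      = τ ⇒ (σ ⊕ τ)
constTy (case σ τ ρ)  = (σ ⊕ τ) ⇒ (σ ⇒ ρ) ⇒ (τ ⇒ ρ) ⇒ ρ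
constTy (pcase σ τ ρ) = (σ ⊕ τ) ⇒ ρ ⇒ ρ ⇒ ρ
constTy (pair σ τ)    = σ ⇒ τ ⇒ (σ ⊗ τ)
constTy (fst σ τ)     = (σ ⊗ τ) ⇒ σ
constTy (snd σ τ)     = (σ ⊗ τ) ⇒ τ
constTy (Ω σ)         = σ

data Term : Set where
  var : ℕ → Term
  lam : Ty → Term → Term
  app : Term → Term → Term
  con : Const → Term

extRen : (ℕ → ℕ) → ℕ → ℕ
extRen ρ zero    = zero
extRen ρ (suc i) = suc (ρ i)

ren : (ℕ → ℕ) → Term → Term
ren ρ (var i)   = var (ρ i)
ren ρ (lam σ M) = lam σ (ren (extRen ρ) M)
ren ρ (app M N) = app (ren ρ M) (ren ρ N)
ren ρ (con c)   = con c

extSub : (ℕ → Term) → ℕ → Term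
extSub s zero    = var zero
extSub s (suc i) = ren suc (s i)

sub : (ℕ → Term) → Term → Term
sub s (var i)   = s i
sub s (lam σ M) = lam σ (sub (extSub s) M)
sub s (app M N) = app (sub s M) (sub s N)
sub s (con c)   = con c

_[0:=_] : Term → Term → Term
M [0:= N ] = sub s M
  where
  s : ℕ → Term
  s zero    = N
  s (suc i) = var i

Ctx : Set
Ctx = List Ty

data _∋_∶_ : Ctx → ℕ → Ty → Set where
  here  : ∀ {Γ σ} → (σ ∷ Γ) ∋ zero ∶ σ
  there : ∀ {Γ σ τ i} → Γ ∋ i ∶ σ → (τ ∷ Γ) ∋ suc i ∶ σ

data _⊢_∶_ (Γ : Ctx) : Term → Ty → Set where
  ⊢con : ∀ {c} → Γ ⊢ con c ∶ constTy c
  ⊢var : ∀ {i σ} → Γ ∋ i ∶ σ → Γ ⊢ var i ∶ σ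
  ⊢lam : ∀ {σ τ M} → (σ ∷ Γ) ⊢ M ∶ τ → Γ ⊢ lam σ M ∶ (σ ⇒ τ)
  ⊢app : ∀ {σ τ M N} → Γ ⊢ M ∶ (σ ⇒ τ) → Γ ⊢ N ∶ σ → Γ ⊢ app M N ∶ τ
  ⊢≈   : ∀ {σ τ M} → Γ ⊢ M ∶ σ → σ ≈ τ → Γ ⊢ M ∶ τ

app3 : Term → Term → Term → Term → Term
app3 f x y z = app (app (app f x) y) z

data _⟶_ : Term → Term → Set where
  β       : ∀ {σ M N} → app (lam σ M) N ⟶ (M [0:= N ])
  appˡ    : ∀ {M M' N} → M ⟶ M' → app M N ⟶ app M' N
  appʳ    : ∀ {M N N'} → N ⟶ N' → app M N ⟶ app M N'
  lamξ    : ∀ {σ M M'} → M ⟶ M' → lam σ M ⟶ lam σ M'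
  case0   : ∀ {a b c d e x y z} →
            app3 (con (case a b c)) (app (con (c0 d e)) x) y z ⟶ app y x
  case1   : ∀ {a b c d e x y z} →
            app3 (con (case a b c)) (app (con (c1 d e)) x) y z ⟶ app z x
  fstβ    : ∀ {a b c d x y} → app (con (fst a b)) (app (app (con (pair c d)) x) y) ⟶ x
  sndβ    : ∀ {a b c d x y} → app (con (snd a b)) (app (app (con (pair c d)) x) y) ⟶ y
  pcase0  : ∀ {a b c d e x y z} →
            app3 (con (pcase a b c)) (app (con (c0 d e)) x) y z ⟶ y
  pcase1  : ∀ {a b c d e x y z} →
            app3 (con (pcase a b c)) (app (con (c1 d e)) x) y z ⟶ z
  pcase00 : ∀ {σ τ ρ₀ ρ₁ a b a' b' x y z} →
            app3 (con (pcase σ τ (ρ₀ ⊕ ρ₁))) x (app (con (c0 a b)) y) (app (con (c0 a' b')) z)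
              ⟶ app (con (c0 ρ₀ ρ₁)) (app3 (con (pcase σ τ ρ₀)) x y z)
  pcase11 : ∀ {σ τ ρ₀ ρ₁ a b a' b' x y z} →
            app3 (con (pcase σ τ (ρ₀ ⊕ ρ₁))) x (app (con (c1 a b)) y) (app (con (c1 a' b')) z)
              ⟶ app (con (c1 ρ₀ ρ₁)) (app3 (con (pcase σ τ ρ₁)) x y z)
  pcase×  : ∀ {σ τ ρ₁ ρ₂ a b a' b' x y₁ y₂ z₁ z₂} →
            app3 (con (pcase σ τ (ρ₁ ⊗ ρ₂))) x
                 (app (app (con (pair a b)) y₁) y₂) (app (app (con (pair a' b')) z₁) z₂)
              ⟶ app (app (con (pair ρ₁ ρ₂))
                       (app3 (con (pcase σ τ ρ₁)) x y₁ z₁))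
                       (app3 (con (pcase σ τ ρ₂)) x y₂ z₂)
  pcase⇒  : ∀ {σ τ ρ₁ ρ₂ x y z w} →
            app (app3 (con (pcase σ τ (ρ₁ ⇒ ρ₂))) x y z) w
              ⟶ app3 (con (pcase σ τ ρ₂)) x (app y w) (app z w)

data _⟶*_ : Term → Term → Set where
  ⟶refl : ∀ {M} → M ⟶* M
  ⟶step : ∀ {M M' M''} → M ⟶ M' → M' ⟶* M'' → M ⟶* M''

-- The only non-routine ingredient is that the three binary connectives
-- +, ×, → are both congruent and injective for ≈.  Both follow from a
-- description of (σ ⋆ τ)↑: unfolding never acts at the root of a compound
-- type, so every unfolding sequence of σ ⋆ τ unfolds σ and τ separately, and
-- (σ ⋆ τ)↑ consists of void together with the s ⋆ t for s ∈ σ↑, t ∈ τ↑.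
module Submission where

open import Defs
open import Data.Nat using (ℕ)
open import Data.List using (_∷_)
open import Data.Product using (Σ; _×_; _,_; proj₁; proj₂)
open import Data.Sum using (_⊎_; inj₁; inj₂)
open import Function.Bundles using (mk⇔; Equivalence)
open import Function.Properties.Equivalence using (⇔-isEquivalence)
open import Relation.Binary.Structures using (IsEquivalence)
import Level
open import Relation.Binary.PropositionalEquality using (_≡_; refl)

-- The binary type connectives, so that facts about +, × and → are stated
-- and proved once.
data Conn : Set where
  sum prod arr : Conn

_⟨_⟩_ : Ty → Conn → Ty → Ty
σ ⟨ sum ⟩ τ  = σ ⊕ τ
σ ⟨ prod ⟩ τ = σ ⊗ τ
σ ⟨ arr ⟩ τ  = σ ⇒ τ

_⟨_⟩ˢ_ : STy → Conn → STy → STy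
s ⟨ sum ⟩ˢ t  = s ⊕ t
s ⟨ prod ⟩ˢ t = s ⊗ t
s ⟨ arr ⟩ˢ t  = s ⇒ t

≼-conn : ∀ ⋆ {s t σ τ} → s ≼ σ → t ≼ τ → (s ⟨ ⋆ ⟩ˢ t) ≼ (σ ⟨ ⋆ ⟩ τ)
≼-conn sum  p q = ⊕≼ p q
≼-conn prod p q = ⊗≼ p q
≼-conn arr  p q = ⇒≼ p q

≼-components : ∀ ⋆ {s t σ τ} → (s ⟨ ⋆ ⟩ˢ t) ≼ (σ ⟨ ⋆ ⟩ τ) → (s ≼ σ) × (t ≼ τ)
≼-components sum  (⊕≼ p q) = p , q
≼-components prod (⊗≼ p q) = p , q
≼-components arr  (⇒≼ p q) = p , q

≼-cases : ∀ ⋆ {u σ τ} → u ≼ (σ ⟨ ⋆ ⟩ τ) →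
  (u ≡ void) ⊎ Σ STy λ s → Σ STy λ t → (u ≡ s ⟨ ⋆ ⟩ˢ t) × (s ≼ σ) × (t ≼ τ)
≼-cases sum  void≼    = inj₁ refl
≼-cases prod void≼    = inj₁ refl
≼-cases arr  void≼    = inj₁ refl
≼-cases sum  (⊕≼ p q) = inj₂ (_ , _ , refl , p , q)
≼-cases prod (⊗≼ p q) = inj₂ (_ , _ , refl , p , q)
≼-cases arr  (⇒≼ p q) = inj₂ (_ , _ , refl , p , q)

▷*-trans : ∀ {ρ σ τ} → ρ ▷* σ → σ ▷* τ → ρ ▷* τ
▷*-trans ▷refl        q = q
▷*-trans (▷step e p) q = ▷step e (▷*-trans p q)

▷-left : ∀ ⋆ {σ σ' τ} → σ ▷ σ' → (σ ⟨ ⋆ ⟩ τ) ▷ (σ' ⟨ ⋆ ⟩ τ)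
▷-left sum  = ⊕ˡ
▷-left prod = ⊗ˡ
▷-left arr  = ⇒ˡ

▷-right : ∀ ⋆ {σ τ τ'} → τ ▷ τ' → (σ ⟨ ⋆ ⟩ τ) ▷ (σ ⟨ ⋆ ⟩ τ')
▷-right sum  = ⊕ʳ
▷-right prod = ⊗ʳ
▷-right arr  = ⇒ʳ

▷*-conn : ∀ ⋆ {σ σ' τ τ'} → σ ▷* σ' → τ ▷* τ' → (σ ⟨ ⋆ ⟩ τ) ▷* (σ' ⟨ ⋆ ⟩ τ')
▷*-conn ⋆ ▷refl        ▷refl        = ▷refl
▷*-conn ⋆ ▷refl        (▷step e q) = ▷step (▷-right ⋆ e) (▷*-conn ⋆ ▷refl q)
▷*-conn ⋆ (▷step e p) q            = ▷step (▷-left ⋆ e) (▷*-conn ⋆ p q)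

▷-conn-inv : ∀ ⋆ {σ τ ρ} → (σ ⟨ ⋆ ⟩ τ) ▷ ρ →
  (Σ Ty λ σ' → (ρ ≡ σ' ⟨ ⋆ ⟩ τ) × (σ ▷ σ')) ⊎ (Σ Ty λ τ' → (ρ ≡ σ ⟨ ⋆ ⟩ τ') × (τ ▷ τ'))
▷-conn-inv sum  (⊕ˡ e) = inj₁ (_ , refl , e)
▷-conn-inv sum  (⊕ʳ e) = inj₂ (_ , refl , e)
▷-conn-inv prod (⊗ˡ e) = inj₁ (_ , refl , e)
▷-conn-inv prod (⊗ʳ e) = inj₂ (_ , refl , e)
▷-conn-inv arr  (⇒ˡ e) = inj₁ (_ , refl , e)
▷-conn-inv arr  (⇒ʳ e) = inj₂ (_ , refl , e)

▷*-conn-inv : ∀ ⋆ {σ τ ρ} → (σ ⟨ ⋆ ⟩ τ) ▷* ρ →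
  Σ Ty λ σ' → Σ Ty λ τ' → (ρ ≡ σ' ⟨ ⋆ ⟩ τ') × (σ ▷* σ') × (τ ▷* τ')
▷*-conn-inv ⋆ ▷refl = _ , _ , refl , ▷refl , ▷refl
▷*-conn-inv ⋆ (▷step e r) with ▷-conn-inv ⋆ e
... | inj₁ (_ , refl , e') with ▷*-conn-inv ⋆ r
...   | σ' , τ' , eq , p , q = σ' , τ' , eq , ▷step e' p , q
▷*-conn-inv ⋆ (▷step e r) | inj₂ (_ , refl , e') with ▷*-conn-inv ⋆ r
...   | σ' , τ' , eq , p , q = σ' , τ' , eq , p , ▷step e' q

void∈↑ : ∀ {τ} → void ∈ τ ↑
void∈↑ = _ , ▷refl , void≼

↑-conn : ∀ ⋆ {s t σ τ} → s ∈ σ ↑ → t ∈ τ ↑ → (s ⟨ ⋆ ⟩ˢ t) ∈ (σ ⟨ ⋆ ⟩ τ) ↑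
↑-conn ⋆ (σ' , p , a) (τ' , q , b) = σ' ⟨ ⋆ ⟩ τ' , ▷*-conn ⋆ p q , ≼-conn ⋆ a b

↑-components : ∀ ⋆ {s t σ τ} → (s ⟨ ⋆ ⟩ˢ t) ∈ (σ ⟨ ⋆ ⟩ τ) ↑ → (s ∈ σ ↑) × (t ∈ τ ↑)
↑-components ⋆ (_ , r , h) with ▷*-conn-inv ⋆ r
... | σ' , τ' , refl , p , q with ≼-components ⋆ h
...   | a , b = (σ' , p , a) , (τ' , q , b)

↑-cases : ∀ ⋆ {u σ τ} → u ∈ (σ ⟨ ⋆ ⟩ τ) ↑ →
  (u ≡ void) ⊎ Σ STy λ s → Σ STy λ t → (u ≡ s ⟨ ⋆ ⟩ˢ t) × (s ∈ σ ↑) × (t ∈ τ ↑)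
↑-cases ⋆ (_ , r , h) with ▷*-conn-inv ⋆ r
... | σ' , τ' , refl , p , q with ≼-cases ⋆ h
...   | inj₁ u≡void = inj₁ u≡void
...   | inj₂ (s , t , eq , a , b) = inj₂ (s , t , eq , (σ' , p , a) , (τ' , q , b))

module ⇔ = IsEquivalence (⇔-isEquivalence {ℓ = Level.zero})

≈-refl : ∀ {σ} → σ ≈ σ
≈-refl s = ⇔.refl

≈-sym : ∀ {σ τ} → σ ≈ τ → τ ≈ σ
≈-sym e s = ⇔.sym (e s)

≈-trans : ∀ {ρ σ τ} → ρ ≈ σ → σ ≈ τ → ρ ≈ τ
≈-trans e f s = ⇔.trans (e s) (f s)

≈-to : ∀ {σ τ} → σ ≈ τ → ∀ {s} → s ∈ σ ↑ → s ∈ τ ↑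
≈-to e {s} = Equivalence.to (e s)

-- Injectivity of the connectives for ≈: probe with s ⋆ void and void ⋆ t.
≈-injˡ : ∀ ⋆ {σ τ σ' τ'} → (σ ⟨ ⋆ ⟩ τ) ≈ (σ' ⟨ ⋆ ⟩ τ') → σ ≈ σ'
≈-injˡ ⋆ e s = mk⇔ (probe e) (probe (≈-sym e))
  where
  probe : ∀ {σ τ σ' τ'} → (σ ⟨ ⋆ ⟩ τ) ≈ (σ' ⟨ ⋆ ⟩ τ') → s ∈ σ ↑ → s ∈ σ' ↑
  probe e x = proj₁ (↑-components ⋆ (≈-to e (↑-conn ⋆ {t = void} x void∈↑)))

≈-injʳ : ∀ ⋆ {σ τ σ' τ'} → (σ ⟨ ⋆ ⟩ τ) ≈ (σ' ⟨ ⋆ ⟩ τ') → τ ≈ τ'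
≈-injʳ ⋆ e t = mk⇔ (probe e) (probe (≈-sym e))
  where
  probe : ∀ {σ τ σ' τ'} → (σ ⟨ ⋆ ⟩ τ) ≈ (σ' ⟨ ⋆ ⟩ τ') → t ∈ τ ↑ → t ∈ τ' ↑
  probe e x = proj₂ (↑-components ⋆ (≈-to e (↑-conn ⋆ {s = void} void∈↑ x)))

≈-conn : ∀ ⋆ {σ τ σ' τ'} → σ ≈ σ' → τ ≈ τ' → (σ ⟨ ⋆ ⟩ τ) ≈ (σ' ⟨ ⋆ ⟩ τ')
≈-conn ⋆ e f u = mk⇔ (transport e f) (transport (≈-sym e) (≈-sym f))
  where
  transport : ∀ {σ τ σ' τ'} → σ ≈ σ' → τ ≈ τ' → u ∈ (σ ⟨ ⋆ ⟩ τ) ↑ → u ∈ (σ' ⟨ ⋆ ⟩ τ') ↑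
  transport e f x with ↑-cases ⋆ x
  ... | inj₁ refl                  = void∈↑
  ... | inj₂ (_ , _ , refl , a , b) = ↑-conn ⋆ (≈-to e a) (≈-to f b)

_⊢ʳ_⇒_ : (ℕ → ℕ) → Ctx → Ctx → Set
ρ ⊢ʳ Γ ⇒ Δ = ∀ {i σ} → Γ ∋ i ∶ σ → Δ ∋ ρ i ∶ σ

extRen-typed : ∀ {Γ Δ ρ τ} → ρ ⊢ʳ Γ ⇒ Δ → extRen ρ ⊢ʳ (τ ∷ Γ) ⇒ (τ ∷ Δ)
extRen-typed ρ-ok here      = here
extRen-typed ρ-ok (there x) = there (ρ-ok x)

ren-typed : ∀ {Γ Δ ρ M σ} → ρ ⊢ʳ Γ ⇒ Δ → Γ ⊢ M ∶ σ → Δ ⊢ ren ρ M ∶ σ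
ren-typed ρ-ok ⊢con       = ⊢con
ren-typed ρ-ok (⊢var x)   = ⊢var (ρ-ok x)
ren-typed ρ-ok (⊢lam d)   = ⊢lam (ren-typed (extRen-typed ρ-ok) d)
ren-typed ρ-ok (⊢app d e) = ⊢app (ren-typed ρ-ok d) (ren-typed ρ-ok e)
ren-typed ρ-ok (⊢≈ d e)   = ⊢≈ (ren-typed ρ-ok d) e

_⊢ˢ_⇒_ : (ℕ → Term) → Ctx → Ctx → Set
s ⊢ˢ Γ ⇒ Δ = ∀ {i σ} → Γ ∋ i ∶ σ → Δ ⊢ s i ∶ σ

extSub-typed : ∀ {Γ Δ s τ} → s ⊢ˢ Γ ⇒ Δ → extSub s ⊢ˢ (τ ∷ Γ) ⇒ (τ ∷ Δ)
extSub-typed s-ok here      = ⊢var here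
extSub-typed s-ok (there x) = ren-typed there (s-ok x)

sub-typed : ∀ {Γ Δ s M σ} → s ⊢ˢ Γ ⇒ Δ → Γ ⊢ M ∶ σ → Δ ⊢ sub s M ∶ σ
sub-typed s-ok ⊢con       = ⊢con
sub-typed s-ok (⊢var x)   = s-ok x
sub-typed s-ok (⊢lam d)   = ⊢lam (sub-typed (extSub-typed s-ok) d)
sub-typed s-ok (⊢app d e) = ⊢app (sub-typed s-ok d) (sub-typed s-ok e)
sub-typed s-ok (⊢≈ d e)   = ⊢≈ (sub-typed s-ok d) e

[0:=]-typed : ∀ {Γ σ τ M N} → (σ ∷ Γ) ⊢ M ∶ τ → Γ ⊢ N ∶ σ → Γ ⊢ M [0:= N ] ∶ τ
[0:=]-typed {Γ} {σ} {N = N} d n = sub-typed N-ok d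
  where
  N-ok : ∀ {i ρ} → (σ ∷ Γ) ∋ i ∶ ρ → Γ ⊢ _ ∶ ρ
  N-ok here      = n
  N-ok (there x) = ⊢var x

-- Generation lemmas: read off a derivation up to ≈, pushing conversions
-- through the codomain of → by congruence.
gen-app : ∀ {Γ M N τ} → Γ ⊢ app M N ∶ τ → Σ Ty λ σ → (Γ ⊢ M ∶ (σ ⇒ τ)) × (Γ ⊢ N ∶ σ)
gen-app (⊢app d e) = _ , d , e
gen-app (⊢≈ d τ≈τ') with gen-app d
... | σ , m , n = σ , ⊢≈ m (≈-conn arr ≈-refl τ≈τ') , n

gen-lam : ∀ {Γ σ M ρ} → Γ ⊢ lam σ M ∶ ρ → Σ Ty λ τ → ((σ ∷ Γ) ⊢ M ∶ τ) × ((σ ⇒ τ) ≈ ρ)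
gen-lam (⊢lam d) = _ , d , ≈-refl
gen-lam (⊢≈ d e) with gen-lam d
... | τ , m , f = τ , m , ≈-trans f e

-- A constant's declared type is ≈ every type derived for it (α is any type
-- equal to the declared one, so that callers can name its components).
gen-con : ∀ {Γ c α ρ} → constTy c ≡ α → Γ ⊢ con c ∶ ρ → α ≈ ρ
gen-con refl ⊢con     = ≈-refl
gen-con refl (⊢≈ d e) = ≈-trans (gen-con refl d) e

gen-con₁ : ∀ {Γ c α ρ x τ} → constTy c ≡ (α ⇒ ρ) →
  Γ ⊢ app (con c) x ∶ τ → (Γ ⊢ x ∶ α) × (ρ ≈ τ)
gen-con₁ eq d with gen-app d
... | _ , dc , dx = ⊢≈ dx (≈-sym (≈-injˡ arr (gen-con eq dc))) , ≈-injʳ arr (gen-con eq dc)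

gen-con₂ : ∀ {Γ c α β ρ x y τ} → constTy c ≡ (α ⇒ β ⇒ ρ) →
  Γ ⊢ app (app (con c) x) y ∶ τ → (Γ ⊢ x ∶ α) × (Γ ⊢ y ∶ β) × (ρ ≈ τ)
gen-con₂ eq d with gen-app d
... | _ , dcx , dy with gen-con₁ eq dcx
...   | dx , e = dx , ⊢≈ dy (≈-sym (≈-injˡ arr e)) , ≈-injʳ arr e

gen-con₃ : ∀ {Γ c α β γ ρ x y z τ} → constTy c ≡ (α ⇒ β ⇒ γ ⇒ ρ) →
  Γ ⊢ app3 (con c) x y z ∶ τ → (Γ ⊢ x ∶ α) × (Γ ⊢ y ∶ β) × (Γ ⊢ z ∶ γ) × (ρ ≈ τ)
gen-con₃ eq d with gen-app d
... | _ , dcxy , dz with gen-con₂ eq dcxy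
...   | dx , dy , e = dx , dy , ⊢≈ dz (≈-sym (≈-injˡ arr e)) , ≈-injʳ arr e

gen-inj₀ : ∀ {Γ σ τ ρ₀ ρ₁ x} → Γ ⊢ app (con (c0 σ τ)) x ∶ (ρ₀ ⊕ ρ₁) → Γ ⊢ x ∶ ρ₀
gen-inj₀ d with gen-con₁ refl d
... | dx , e = ⊢≈ dx (≈-injˡ sum e)

gen-inj₁ : ∀ {Γ σ τ ρ₀ ρ₁ x} → Γ ⊢ app (con (c1 σ τ)) x ∶ (ρ₀ ⊕ ρ₁) → Γ ⊢ x ∶ ρ₁
gen-inj₁ d with gen-con₁ refl d
... | dx , e = ⊢≈ dx (≈-injʳ sum e)

gen-pair : ∀ {Γ σ τ ρ₁ ρ₂ x y} → Γ ⊢ app (app (con (pair σ τ)) x) y ∶ (ρ₁ ⊗ ρ₂) →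
  (Γ ⊢ x ∶ ρ₁) × (Γ ⊢ y ∶ ρ₂)
gen-pair d with gen-con₂ refl d
... | dx , dy , e = ⊢≈ dx (≈-injˡ prod e) , ⊢≈ dy (≈-injʳ prod e)

⊢pcase : ∀ {Γ σ τ ρ x y z} → Γ ⊢ x ∶ (σ ⊕ τ) → Γ ⊢ y ∶ ρ → Γ ⊢ z ∶ ρ →
  Γ ⊢ app3 (con (pcase σ τ ρ)) x y z ∶ ρ
⊢pcase dx dy dz = ⊢app (⊢app (⊢app ⊢con dx) dy) dz

preservation : ∀ {Γ M N τ} → Γ ⊢ M ∶ τ → M ⟶ N → Γ ⊢ N ∶ τ
preservation d β with gen-app d
... | _ , dl , dn with gen-lam dl
...   | _ , dm , e = ⊢≈ ([0:=]-typed dm (⊢≈ dn (≈-sym (≈-injˡ arr e)))) (≈-injʳ arr e)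
preservation d (appˡ r) with gen-app d
... | _ , dm , dn = ⊢app (preservation dm r) dn
preservation d (appʳ r) with gen-app d
... | _ , dm , dn = ⊢app dm (preservation dn r)
preservation d (lamξ r) with gen-lam d
... | _ , dm , e = ⊢≈ (⊢lam (preservation dm r)) e
preservation d case0 with gen-con₃ refl d
... | dx , dy , _ , e = ⊢≈ (⊢app dy (gen-inj₀ dx)) e
preservation d case1 with gen-con₃ refl d
... | dx , _ , dz , e = ⊢≈ (⊢app dz (gen-inj₁ dx)) e
preservation d fstβ with gen-con₁ refl d
... | dp , e = ⊢≈ (proj₁ (gen-pair dp)) e
preservation d sndβ with gen-con₁ refl d
... | dp , e = ⊢≈ (proj₂ (gen-pair dp)) e
preservation d pcase0 with gen-con₃ refl d
... | _ , dy , _ , e = ⊢≈ dy e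
preservation d pcase1 with gen-con₃ refl d
... | _ , _ , dz , e = ⊢≈ dz e
preservation d pcase00 with gen-con₃ refl d
... | dx , dy , dz , e = ⊢≈ (⊢app ⊢con (⊢pcase dx (gen-inj₀ dy) (gen-inj₀ dz))) e
preservation d pcase11 with gen-con₃ refl d
... | dx , dy , dz , e = ⊢≈ (⊢app ⊢con (⊢pcase dx (gen-inj₁ dy) (gen-inj₁ dz))) e
preservation d pcase× with gen-con₃ refl d
... | dx , dy , dz , e with gen-pair dy | gen-pair dz
...   | dy₁ , dy₂ | dz₁ , dz₂ =
  ⊢≈ (⊢app (⊢app ⊢con (⊢pcase dx dy₁ dz₁)) (⊢pcase dx dy₂ dz₂)) e
preservation d pcase⇒ with gen-app d
... | _ , dp , dw with gen-con₃ refl dp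
...   | dx , dy , dz , e =
  ⊢≈ (⊢pcase dx (⊢app dy dw') (⊢app dz dw')) (≈-injʳ arr e)
  where dw' = ⊢≈ dw (≈-sym (≈-injˡ arr e))

mainTheorem2 : ∀ (Γ : Ctx) (M N : Term) (σ : Ty) → Γ ⊢ M ∶ σ → M ⟶* N → Γ ⊢ N ∶ σ
mainTheorem2 Γ M .M σ d ⟶refl        = d
mainTheorem2 Γ M N  σ d (⟶step r rs) = mainTheorem2 Γ _ N σ (preservation d r) rs
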